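{- Let $B$ be a board in the triangular grid or in the hexagonal grid. Then $x(B) \le f(B)$.
   Context: The triangular grid is the tiling of the plane by congruent equilateral triangles (cells); the hexagonal grid is the tiling of the plane by congruent regular hexagons (cells). In either grid two cells are neighbors if they share an edge. A board is a finite set $B$ of cells such that every cell of $B$ has at least one neighbor in $B$. A fragment is a set of cells consisting of a cell $c$ together with a nonempty subset of the neighbors of $c$ in the grid; a maximal fragment is a cell together with all of its neighbors in the grid (4 cells in the triangular grid, 7 cells in the hexagonal grid). $x(B)$ is the minimal number of maximal fragments (placed in the grid) whose union contains $B$; they may overlap each other and may contain cells outside $B$. A fragment tiling of $B$ is a partition of $B$ into fragments, each contained in $B$; $f(B)$ is the minimum number of fragments in a fragment tiling of $B$. -}

module Defs where

open import Data.Integer using (ℤ; _+_; _-_; 1ℤ)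
open import Data.Bool using (Bool; true; false)
open import Data.Product using (_×_; _,_; Σ; ∃; ∃-syntax)
open import Data.Sum using (_⊎_)
open import Data.List using (List; []; _∷_; concatMap)
open import Data.List.Membership.Propositional using (_∈_)
open import Data.List.Relation.Unary.All using (All)
open import Data.List.Relation.Unary.Unique.Propositional using (Unique)
open import Data.List.Relation.Binary.Permutation.Propositional using (_↭_)
open import Relation.Binary.PropositionalEquality using (_≡_)
open import Relation.Nullary using (¬_)

data Grid : Set where
  triangular hexagonal : Grid

-- Triangular grid: cell (a , b , true) is the "up" triangle with vertices
-- v, v+e1, v+e2 (v = a e1 + b e2); (a , b , false) is the "down" triangle with
-- vertices v+e1, v+e2, v+e1+e2.
TriCell : Set
TriCell = ℤ × ℤ × Bool

data TriAdj : TriCell → TriCell → Set where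
  up₀   : ∀ a b → TriAdj (a , b , true) (a , b , false)
  up₁   : ∀ a b → TriAdj (a , b , true) (a - 1ℤ , b , false)
  up₂   : ∀ a b → TriAdj (a , b , true) (a , b - 1ℤ , false)
  down₀ : ∀ a b → TriAdj (a , b , false) (a , b , true)
  down₁ : ∀ a b → TriAdj (a , b , false) (a + 1ℤ , b , true)
  down₂ : ∀ a b → TriAdj (a , b , false) (a , b + 1ℤ , true)

-- Hexagonal grid in axial coordinates.
HexCell : Set
HexCell = ℤ × ℤ

data HexAdj : HexCell → HexCell → Set where
  h₁ : ∀ a b → HexAdj (a , b) (a + 1ℤ , b)
  h₂ : ∀ a b → HexAdj (a , b) (a - 1ℤ , b)
  h₃ : ∀ a b → HexAdj (a , b) (a , b + 1ℤ)
  h₄ : ∀ a b → HexAdj (a , b) (a , b - 1ℤ)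
  h₅ : ∀ a b → HexAdj (a , b) (a + 1ℤ , b - 1ℤ)
  h₆ : ∀ a b → HexAdj (a , b) (a - 1ℤ , b + 1ℤ)

Cell : Grid → Set
Cell triangular = TriCell
Cell hexagonal  = HexCell

Adj : (g : Grid) → Cell g → Cell g → Set
Adj triangular = TriAdj
Adj hexagonal  = HexAdj

IsBoard : (g : Grid) → List (Cell g) → Set
IsBoard g B = Unique B × (∀ {c} → c ∈ B → ∃[ d ] (d ∈ B × Adj g c d))

record Fragment (g : Grid) : Set where
  constructor fragment
  field
    center   : Cell g
    nbrs     : List (Cell g)
    nonempty : ¬ (nbrs ≡ [])
    areNbrs  : All (Adj g center) nbrs

fragCells : {g : Grid} → Fragment g → List (Cell g)
fragCells F = Fragment.center F ∷ Fragment.nbrs F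

-- A fragment tiling of B: a list of fragments partitioning B
-- (the multiset union of their cells is exactly B; since B has no
-- duplicates this forces pairwise disjointness and containment in B).
IsFragmentTiling : (g : Grid) → List (Cell g) → List (Fragment g) → Set
IsFragmentTiling g B T = concatMap fragCells T ↭ B

InMaxFragment : (g : Grid) → Cell g → Cell g → Set
InMaxFragment g c d = d ≡ c ⊎ Adj g c d

CoversByMaxFragments : (g : Grid) → List (Cell g) → List (Cell g) → Set
CoversByMaxFragments g B cs = ∀ {d} → d ∈ B → ∃[ c ] (c ∈ cs × InMaxFragment g c d)

-- Every fragment lies inside the maximal fragment with the same center, so
-- the centers of the fragments of any tiling of B are the centers of a cover
-- of B by equally many maximal fragments.
module Submission where

open import Defs
open import Data.Nat using (_≤_)
open import Data.Nat.Properties using (≤-reflexive)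
open import Data.List using (List; length; map; concatMap)
open import Data.List.Properties using (length-map)
open import Data.List.Membership.Propositional using (_∈_; find)
open import Data.List.Membership.Propositional.Properties using (∈-map⁺; ∈-concatMap⁻)
open import Data.List.Relation.Unary.Any using (here; there)
open import Data.List.Relation.Unary.All using (lookup)
open import Data.List.Relation.Binary.Permutation.Propositional using (↭-sym)
open import Data.List.Relation.Binary.Permutation.Propositional.Properties using (∈-resp-↭)
open import Data.Product using (_×_; ∃-syntax; _,_)
open import Data.Sum using (inj₁; inj₂)

module _ {g : Grid} where

  open Fragment

  fragCells⊆maxFragment : (F : Fragment g) → ∀ {d} → d ∈ fragCells F →
    InMaxFragment g (center F) d
  fragCells⊆maxFragment F (here d≡c)  = inj₁ d≡c
  fragCells⊆maxFragment F (there d∈N) = inj₂ (lookup (areNbrs F) d∈N)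

  centers-cover-fragCells : (T : List (Fragment g)) →
    CoversByMaxFragments g (concatMap fragCells T) (map center T)
  centers-cover-fragCells T d∈T with find (∈-concatMap⁻ fragCells {xs = T} d∈T)
  ... | F , F∈T , d∈F = center F , ∈-map⁺ center F∈T , fragCells⊆maxFragment F d∈F

mainTheorem10 : (g : Grid) (B : List (Cell g)) → IsBoard g B →
    (T : List (Fragment g)) → IsFragmentTiling g B T →
    ∃[ cs ] (length cs ≤ length T × CoversByMaxFragments g B cs)
mainTheorem10 g B _ T T-tiles-B =
  map Fragment.center T ,
  ≤-reflexive (length-map Fragment.center T) ,
  λ d∈B → centers-cover-fragCells T (∈-resp-↭ (↭-sym T-tiles-B) d∈B)
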